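{- Let $K$ be an algebraically closed field of characteristic $0$, let $f,g\in K[t]$ be nonconstant relatively prime polynomials, let $w\in K[t]$ be nonzero, and put $A=f^2-g^2$, $B=2fg$, $C=f^2+g^2$. Suppose $(x,y,z)$ is a triple of positive integers with $(wA)^x+(wB)^y=(wC)^z$. If $x=y=2$, or $x=z=2$, or $y=z=2$, then $(x,y,z)=(2,2,2)$. -}

module Defs where

open import Level using (Level; _⊔_)
open import Algebra.Bundles using (CommutativeRing)
open import Data.Nat using (ℕ; zero; suc)
open import Data.List using (List; []; _∷_; map)
open import Data.Product using (_×_; ∃)
open import Relation.Nullary using (¬_)
open import Relation.Binary.PropositionalEquality using (_≡_)

module _ {c ℓ : Level} (K : CommutativeRing c ℓ) where
  open CommutativeRing K

  IsField : Set (c ⊔ ℓ)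
  IsField = (¬ (1# ≈ 0#)) × (∀ x → ¬ (x ≈ 0#) → ∃ λ y → (x * y) ≈ 1#)

  fromℕ : ℕ → Carrier
  fromℕ zero = 0#
  fromℕ (suc n) = 1# + fromℕ n

  CharZero : Set ℓ
  CharZero = ∀ n → ¬ (fromℕ (suc n) ≈ 0#)

-- Univariate polynomials K[t] over a commutative ring K,
-- represented by coefficient lists (constant term first),
-- with equality up to trailing zero coefficients.
module Poly {c ℓ : Level} (K : CommutativeRing c ℓ) where
  open CommutativeRing K

  Pol : Set c
  Pol = List Carrier

  infix 4 _≈ₚ_
  data _≈ₚ_ : Pol → Pol → Set (c ⊔ ℓ) where
    []≈[] : [] ≈ₚ []
    []≈∷  : ∀ {b q} → b ≈ 0# → [] ≈ₚ q → [] ≈ₚ (b ∷ q)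
    ∷≈[]  : ∀ {a p} → a ≈ 0# → p ≈ₚ [] → (a ∷ p) ≈ₚ []
    ∷≈∷   : ∀ {a b p q} → a ≈ b → p ≈ₚ q → (a ∷ p) ≈ₚ (b ∷ q)

  0ₚ : Pol
  0ₚ = []

  const : Carrier → Pol
  const a = a ∷ []

  1ₚ : Pol
  1ₚ = const 1#

  2K : Carrier
  2K = 1# + 1#

  infixl 6 _+ₚ_ _-ₚ_
  infixl 7 _*ₚ_ _·ₚ_
  infixr 8 _^ₚ_

  _+ₚ_ : Pol → Pol → Pol
  [] +ₚ q = q
  (a ∷ p) +ₚ [] = a ∷ p
  (a ∷ p) +ₚ (b ∷ q) = (a + b) ∷ (p +ₚ q)

  -ₚ_ : Pol → Pol
  -ₚ p = map -_ p

  _-ₚ_ : Pol → Pol → Pol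
  p -ₚ q = p +ₚ (-ₚ q)

  _·ₚ_ : Carrier → Pol → Pol
  a ·ₚ p = map (a *_) p

  _*ₚ_ : Pol → Pol → Pol
  [] *ₚ q = []
  (a ∷ p) *ₚ q = (a ·ₚ q) +ₚ (0# ∷ (p *ₚ q))

  _^ₚ_ : Pol → ℕ → Pol
  p ^ₚ zero = 1ₚ
  p ^ₚ suc n = p *ₚ (p ^ₚ n)

  eval : Pol → Carrier → Carrier
  eval [] x = 0#
  eval (a ∷ p) x = a + x * eval p x

  IsConstant : Pol → Set (c ⊔ ℓ)
  IsConstant p = ∃ λ a → p ≈ₚ const a

  NonConstant : Pol → Set (c ⊔ ℓ)
  NonConstant p = ¬ IsConstant p

  infix 4 _∣ₚ_
  _∣ₚ_ : Pol → Pol → Set (c ⊔ ℓ)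
  d ∣ₚ p = ∃ λ q → p ≈ₚ q *ₚ d

  -- relatively prime: every common divisor is a constant (hence a unit,
  -- as soon as one of the polynomials is nonzero)
  RelPrime : Pol → Pol → Set (c ⊔ ℓ)
  RelPrime f g = ∀ d → d ∣ₚ f → d ∣ₚ g → IsConstant d

AlgClosed : {c ℓ : Level} (K : CommutativeRing c ℓ) → Set (c ⊔ ℓ)
AlgClosed K = ∀ p → NonConstant p → ∃ λ x → eval p x ≈ 0#
  where open CommutativeRing K
        open Poly K

{-# OPTIONS --safe #-}
-- Euclid's formula gives (wA)² + (wB)² = (wC)², so whenever two of the exponents are 2, cancelling
-- against it leaves Pⁿ = P² for one of P = wA, wB, wC.  Each such P is nonconstant, so by algebraic
-- closure it takes the value 2 somewhere; there 2ⁿ = 4 in K, hence n = 2 in characteristic 0.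
-- For A and C, write f² + c g² = (f + s g)(f − s g) with s² = −c.  If this were a constant, then either
-- it is 0 and one factor vanishes, making g divide f; or it is a unit, so both factors are constant
-- (a nonconstant factor would have a root), and then so is their sum 2f.
module Submission where

open import Defs
open import Level using (Level; _⊔_)
open import Algebra.Bundles using (CommutativeRing; CommutativeSemigroup)
open import Data.Nat as ℕ using (ℕ; zero; suc; _≤_)
open import Data.Product using (_×_; _,_; proj₁; proj₂; ∃)
open import Data.Sum using (_⊎_; inj₁; inj₂)
open import Relation.Nullary using (¬_; yes; no)
open import Relation.Binary.PropositionalEquality as ≡ using (_≡_)

import Algebra.Properties.Group as GroupProperties
import Algebra.Properties.Ring as RingProperties
import Algebra.Properties.Semiring.Exp as ExpProperties
import Algebra.Solver.Ring.NaturalCoefficients.Default as SemiringSolver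
import Data.Nat.Properties as ℕ
open import Data.Empty using (⊥-elim)
open import Data.List using ([]; _∷_)
open import Function using (_∘_)
open import Relation.Binary.Definitions using (tri<; tri≈; tri>)
open import Relation.Binary.Structures using (IsEquivalence)
import Relation.Binary.Reasoning.Setoid as SetoidReasoning
open import Relation.Nullary.Decidable using (¬¬-excluded-middle)

^-injectiveʳ : ∀ {b m n} → 1 ℕ.< b → b ℕ.^ m ≡ b ℕ.^ n → m ≡ n
^-injectiveʳ {b} {m} {n} 1<b bᵐ≡bⁿ with ℕ.<-cmp m n
... | tri< m<n _ _ = ⊥-elim (ℕ.<-irrefl bᵐ≡bⁿ (ℕ.^-monoʳ-< b 1<b m<n))
... | tri≈ _ m≡n _ = m≡n
... | tri> _ _ n<m = ⊥-elim (ℕ.<-irrefl (≡.sym bᵐ≡bⁿ) (ℕ.^-monoʳ-< b 1<b n<m))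

module _ {c ℓ : Level} (R : CommutativeRing c ℓ) where
  open CommutativeRing R
  open import Algebra.Properties.Semiring.Exp semiring using (_^_; ^-congˡ)
  open import Algebra.Properties.Group +-group using (//-rightDividesˡ)
  open SemiringSolver commutativeSemiring
  open SetoidReasoning setoid

  -- The semiring solver has no subtraction, so f² is traded for (f² − g²) + g² by hand.
  euclidsFormula : ∀ w f g →
    (w * (f ^ 2 - g ^ 2)) ^ 2 + (w * (f * g + f * g)) ^ 2 ≈ (w * (f ^ 2 + g ^ 2)) ^ 2
  euclidsFormula w f g = begin
    (w * d) ^ 2 + (w * (f * g + f * g)) ^ 2          ≈⟨ +-congˡ (expand w f g) ⟩
    (w * d) ^ 2 + (w * g) ^ 2 * ((F + F) + (F + F))  ≈⟨ +-congˡ (*-congˡ (+-cong F+F≈E+E F+F≈E+E)) ⟩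
    (w * d) ^ 2 + (w * g) ^ 2 * ((E + E) + (E + E))  ≈⟨ collect w d g ⟩
    (w * (E + G)) ^ 2                                ≈⟨ ^-congˡ 2 (*-congˡ (+-congʳ E≈F)) ⟩
    (w * (F + G)) ^ 2                                ∎
    where
    F G d E : Carrier
    F = f ^ 2
    G = g ^ 2
    d = F - G
    E = d + G
    E≈F : E ≈ F
    E≈F = //-rightDividesˡ G F
    F+F≈E+E : F + F ≈ E + E
    F+F≈E+E = sym (+-cong E≈F E≈F)
    expand = solve 3 (λ w f g → (w :* (f :* g :+ f :* g)) :^ 2
                                := (w :* g) :^ 2 :* ((f :^ 2 :+ f :^ 2) :+ (f :^ 2 :+ f :^ 2))) refl
    collect = solve 3 (λ w d g → let e = d :+ g :^ 2 in
                                 (w :* d) :^ 2 :+ (w :* g) :^ 2 :* ((e :+ e) :+ (e :+ e)) := (w :* (e :+ g :^ 2)) :^ 2) refl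

module Polynomials {c ℓ : Level} (K : CommutativeRing c ℓ) where
  open CommutativeRing K
  open import Algebra.Properties.Semiring.Exp semiring using (_^_)
  open Poly K
  open import Algebra.Properties.Ring ring using (-0#≈0#; -1*x≈-x)

  ≈ₚ-refl : ∀ {p} → p ≈ₚ p
  ≈ₚ-refl {[]} = []≈[]
  ≈ₚ-refl {a ∷ p} = ∷≈∷ refl ≈ₚ-refl

  ≈ₚ-sym : ∀ {p q} → p ≈ₚ q → q ≈ₚ p
  ≈ₚ-sym []≈[] = []≈[]
  ≈ₚ-sym ([]≈∷ b≈0 e) = ∷≈[] b≈0 (≈ₚ-sym e)
  ≈ₚ-sym (∷≈[] a≈0 e) = []≈∷ a≈0 (≈ₚ-sym e)
  ≈ₚ-sym (∷≈∷ a≈b e) = ∷≈∷ (sym a≈b) (≈ₚ-sym e)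

  ≈ₚ-trans : ∀ {p q r} → p ≈ₚ q → q ≈ₚ r → p ≈ₚ r
  ≈ₚ-trans []≈[] e = e
  ≈ₚ-trans ([]≈∷ _ _) (∷≈[] _ _) = []≈[]
  ≈ₚ-trans ([]≈∷ b≈0 e) (∷≈∷ b≈c e′) = []≈∷ (trans (sym b≈c) b≈0) (≈ₚ-trans e e′)
  ≈ₚ-trans (∷≈[] a≈0 e) []≈[] = ∷≈[] a≈0 e
  ≈ₚ-trans (∷≈[] a≈0 e) ([]≈∷ c≈0 e′) = ∷≈∷ (trans a≈0 (sym c≈0)) (≈ₚ-trans e e′)
  ≈ₚ-trans (∷≈∷ a≈b e) (∷≈[] b≈0 e′) = ∷≈[] (trans a≈b b≈0) (≈ₚ-trans e e′)
  ≈ₚ-trans (∷≈∷ a≈b e) (∷≈∷ b≈c e′) = ∷≈∷ (trans a≈b b≈c) (≈ₚ-trans e e′)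

  ≈ₚ-isEquivalence : IsEquivalence _≈ₚ_
  ≈ₚ-isEquivalence = record { refl = ≈ₚ-refl ; sym = ≈ₚ-sym ; trans = ≈ₚ-trans }

  ∷≈[]⇒≈[] : ∀ {a p} → a ∷ p ≈ₚ [] → p ≈ₚ []
  ∷≈[]⇒≈[] (∷≈[] _ p≈[]) = p≈[]

  +ₚ-identityˡ : ∀ p → [] +ₚ p ≈ₚ p
  +ₚ-identityˡ p = ≈ₚ-refl

  +ₚ-identityʳ : ∀ p → p +ₚ [] ≈ₚ p
  +ₚ-identityʳ [] = []≈[]
  +ₚ-identityʳ (a ∷ p) = ≈ₚ-refl

  +ₚ-comm : ∀ p q → p +ₚ q ≈ₚ q +ₚ p
  +ₚ-comm [] q = ≈ₚ-sym (+ₚ-identityʳ q)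
  +ₚ-comm (a ∷ p) [] = ≈ₚ-refl
  +ₚ-comm (a ∷ p) (b ∷ q) = ∷≈∷ (+-comm a b) (+ₚ-comm p q)

  +ₚ-assoc : ∀ p q r → (p +ₚ q) +ₚ r ≈ₚ p +ₚ (q +ₚ r)
  +ₚ-assoc [] q r = ≈ₚ-refl
  +ₚ-assoc (a ∷ p) [] r = ≈ₚ-refl
  +ₚ-assoc (a ∷ p) (b ∷ q) [] = ≈ₚ-refl
  +ₚ-assoc (a ∷ p) (b ∷ q) (c ∷ r) = ∷≈∷ (+-assoc a b c) (+ₚ-assoc p q r)

  +ₚ-congʳ : ∀ {p p′} → p ≈ₚ p′ → ∀ q → p +ₚ q ≈ₚ p′ +ₚ q
  +ₚ-congʳ []≈[] q = ≈ₚ-refl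
  +ₚ-congʳ e@([]≈∷ _ _) [] = e
  +ₚ-congʳ ([]≈∷ b≈0 e) (c ∷ q) = ∷≈∷ (sym (trans (+-congʳ b≈0) (+-identityˡ c))) (+ₚ-congʳ e q)
  +ₚ-congʳ e@(∷≈[] _ _) [] = e
  +ₚ-congʳ (∷≈[] a≈0 e) (c ∷ q) = ∷≈∷ (trans (+-congʳ a≈0) (+-identityˡ c)) (+ₚ-congʳ e q)
  +ₚ-congʳ e@(∷≈∷ _ _) [] = e
  +ₚ-congʳ (∷≈∷ a≈b e) (c ∷ q) = ∷≈∷ (+-congʳ a≈b) (+ₚ-congʳ e q)

  +ₚ-congˡ : ∀ p {q q′} → q ≈ₚ q′ → p +ₚ q ≈ₚ p +ₚ q′
  +ₚ-congˡ p {q} {q′} q≈q′ = ≈ₚ-trans (+ₚ-comm p q) (≈ₚ-trans (+ₚ-congʳ q≈q′ p) (+ₚ-comm q′ p))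

  +ₚ-cong : ∀ {p p′ q q′} → p ≈ₚ p′ → q ≈ₚ q′ → p +ₚ q ≈ₚ p′ +ₚ q′
  +ₚ-cong {p′ = p′} {q = q} p≈p′ q≈q′ = ≈ₚ-trans (+ₚ-congʳ p≈p′ q) (+ₚ-congˡ p′ q≈q′)

  +ₚ-commutativeSemigroup : CommutativeSemigroup c (c ⊔ ℓ)
  +ₚ-commutativeSemigroup = record
    { _≈_ = _≈ₚ_
    ; _∙_ = _+ₚ_
    ; isCommutativeSemigroup = record
      { isSemigroup = record
        { isMagma = record { isEquivalence = ≈ₚ-isEquivalence ; ∙-cong = +ₚ-cong }
        ; assoc = +ₚ-assoc
        }
      ; comm = +ₚ-comm
      }
    }

  open import Algebra.Properties.CommutativeSemigroup +ₚ-commutativeSemigroup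
    using (interchange; x∙yz≈y∙xz)

  -ₚ-cong : ∀ {p q} → p ≈ₚ q → -ₚ p ≈ₚ -ₚ q
  -ₚ-cong []≈[] = []≈[]
  -ₚ-cong ([]≈∷ b≈0 e) = []≈∷ (trans (-‿cong b≈0) -0#≈0#) (-ₚ-cong e)
  -ₚ-cong (∷≈[] a≈0 e) = ∷≈[] (trans (-‿cong a≈0) -0#≈0#) (-ₚ-cong e)
  -ₚ-cong (∷≈∷ a≈b e) = ∷≈∷ (-‿cong a≈b) (-ₚ-cong e)

  -ₚ-inverseˡ : ∀ p → -ₚ p +ₚ p ≈ₚ []
  -ₚ-inverseˡ [] = []≈[]
  -ₚ-inverseˡ (a ∷ p) = ∷≈[] (-‿inverseˡ a) (-ₚ-inverseˡ p)

  -ₚ-inverseʳ : ∀ p → p +ₚ -ₚ p ≈ₚ []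
  -ₚ-inverseʳ [] = []≈[]
  -ₚ-inverseʳ (a ∷ p) = ∷≈[] (-‿inverseʳ a) (-ₚ-inverseʳ p)

  -ₚ≈-1#·ₚ : ∀ p → -ₚ p ≈ₚ - 1# ·ₚ p
  -ₚ≈-1#·ₚ [] = []≈[]
  -ₚ≈-1#·ₚ (a ∷ p) = ∷≈∷ (sym (-1*x≈-x a)) (-ₚ≈-1#·ₚ p)

  ·ₚ-congˡ : ∀ a {p q} → p ≈ₚ q → a ·ₚ p ≈ₚ a ·ₚ q
  ·ₚ-congˡ a []≈[] = []≈[]
  ·ₚ-congˡ a ([]≈∷ b≈0 e) = []≈∷ (trans (*-congˡ b≈0) (zeroʳ a)) (·ₚ-congˡ a e)
  ·ₚ-congˡ a (∷≈[] b≈0 e) = ∷≈[] (trans (*-congˡ b≈0) (zeroʳ a)) (·ₚ-congˡ a e)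
  ·ₚ-congˡ a (∷≈∷ b≈c e) = ∷≈∷ (*-congˡ b≈c) (·ₚ-congˡ a e)

  ·ₚ-congʳ : ∀ {a b} → a ≈ b → ∀ p → a ·ₚ p ≈ₚ b ·ₚ p
  ·ₚ-congʳ a≈b [] = []≈[]
  ·ₚ-congʳ a≈b (c ∷ p) = ∷≈∷ (*-congʳ a≈b) (·ₚ-congʳ a≈b p)

  ·ₚ-zeroˡ : ∀ p → 0# ·ₚ p ≈ₚ []
  ·ₚ-zeroˡ [] = []≈[]
  ·ₚ-zeroˡ (a ∷ p) = ∷≈[] (zeroˡ a) (·ₚ-zeroˡ p)

  ·ₚ-identityˡ : ∀ p → 1# ·ₚ p ≈ₚ p
  ·ₚ-identityˡ [] = []≈[]
  ·ₚ-identityˡ (a ∷ p) = ∷≈∷ (*-identityˡ a) (·ₚ-identityˡ p)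

  ·ₚ-assoc : ∀ a b p → (a * b) ·ₚ p ≈ₚ a ·ₚ (b ·ₚ p)
  ·ₚ-assoc a b [] = []≈[]
  ·ₚ-assoc a b (c ∷ p) = ∷≈∷ (*-assoc a b c) (·ₚ-assoc a b p)

  ·ₚ-distribˡ : ∀ a p q → a ·ₚ (p +ₚ q) ≈ₚ a ·ₚ p +ₚ a ·ₚ q
  ·ₚ-distribˡ a [] q = ≈ₚ-refl
  ·ₚ-distribˡ a (b ∷ p) [] = ≈ₚ-refl
  ·ₚ-distribˡ a (b ∷ p) (c ∷ q) = ∷≈∷ (distribˡ a b c) (·ₚ-distribˡ a p q)

  ·ₚ-distribʳ : ∀ a b p → (a + b) ·ₚ p ≈ₚ a ·ₚ p +ₚ b ·ₚ p
  ·ₚ-distribʳ a b [] = []≈[]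
  ·ₚ-distribʳ a b (c ∷ p) = ∷≈∷ (distribʳ c a b) (·ₚ-distribʳ a b p)

  2K·ₚ-double : ∀ p → 2K ·ₚ p ≈ₚ p +ₚ p
  2K·ₚ-double p = ≈ₚ-trans (·ₚ-distribʳ 1# 1# p) (+ₚ-cong (·ₚ-identityˡ p) (·ₚ-identityˡ p))

  0∷-*ₚ : ∀ p q → (0# ∷ p) *ₚ q ≈ₚ 0# ∷ (p *ₚ q)
  0∷-*ₚ p q = +ₚ-congʳ (·ₚ-zeroˡ q) (0# ∷ (p *ₚ q))

  const-*ₚ : ∀ a p → const a *ₚ p ≈ₚ a ·ₚ p
  const-*ₚ a [] = ∷≈[] refl []≈[]
  const-*ₚ a (b ∷ p) = ∷≈∷ (+-identityʳ (a * b)) (+ₚ-identityʳ (a ·ₚ p))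

  *ₚ-congʳ : ∀ {p p′} → p ≈ₚ p′ → ∀ q → p *ₚ q ≈ₚ p′ *ₚ q
  *ₚ-congʳ []≈[] q = []≈[]
  *ₚ-congʳ ([]≈∷ {q = p′} b≈0 e) q =
    ≈ₚ-sym (≈ₚ-trans (+ₚ-congʳ (≈ₚ-trans (·ₚ-congʳ b≈0 q) (·ₚ-zeroˡ q)) (0# ∷ (p′ *ₚ q)))
                     (∷≈[] refl (≈ₚ-sym (*ₚ-congʳ e q))))
  *ₚ-congʳ (∷≈[] {p = p} a≈0 e) q =
    ≈ₚ-trans (+ₚ-congʳ (≈ₚ-trans (·ₚ-congʳ a≈0 q) (·ₚ-zeroˡ q)) (0# ∷ (p *ₚ q)))
             (∷≈[] refl (*ₚ-congʳ e q))
  *ₚ-congʳ (∷≈∷ a≈b e) q = +ₚ-cong (·ₚ-congʳ a≈b q) (∷≈∷ refl (*ₚ-congʳ e q))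

  *ₚ-congˡ : ∀ p {q q′} → q ≈ₚ q′ → p *ₚ q ≈ₚ p *ₚ q′
  *ₚ-congˡ [] e = []≈[]
  *ₚ-congˡ (a ∷ p) e = +ₚ-cong (·ₚ-congˡ a e) (∷≈∷ refl (*ₚ-congˡ p e))

  *ₚ-cong : ∀ {p p′ q q′} → p ≈ₚ p′ → q ≈ₚ q′ → p *ₚ q ≈ₚ p′ *ₚ q′
  *ₚ-cong {p′ = p′} {q = q} p≈p′ q≈q′ = ≈ₚ-trans (*ₚ-congʳ p≈p′ q) (*ₚ-congˡ p′ q≈q′)

  *ₚ-zeroʳ : ∀ p → p *ₚ [] ≈ₚ []
  *ₚ-zeroʳ [] = []≈[]
  *ₚ-zeroʳ (a ∷ p) = ∷≈[] refl (*ₚ-zeroʳ p)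

  *ₚ-∷ : ∀ p b q → p *ₚ (b ∷ q) ≈ₚ b ·ₚ p +ₚ (0# ∷ (p *ₚ q))
  *ₚ-∷ [] b q = []≈∷ refl []≈[]
  *ₚ-∷ (a ∷ p) b q =
    ∷≈∷ (+-congʳ (*-comm a b))
      (≈ₚ-trans (+ₚ-cong (≈ₚ-refl {a ·ₚ q}) (*ₚ-∷ p b q))
                (x∙yz≈y∙xz (a ·ₚ q) (b ·ₚ p) (0# ∷ (p *ₚ q))))

  *ₚ-comm : ∀ p q → p *ₚ q ≈ₚ q *ₚ p
  *ₚ-comm p [] = *ₚ-zeroʳ p
  *ₚ-comm p (b ∷ q) = ≈ₚ-trans (*ₚ-∷ p b q) (+ₚ-cong (≈ₚ-refl {b ·ₚ p}) (∷≈∷ refl (*ₚ-comm p q)))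

  *ₚ-0∷ : ∀ p q → p *ₚ (0# ∷ q) ≈ₚ 0# ∷ (p *ₚ q)
  *ₚ-0∷ p q = ≈ₚ-trans (*ₚ-∷ p 0# q) (+ₚ-congʳ (·ₚ-zeroˡ p) (0# ∷ (p *ₚ q)))

  *ₚ-distribʳ : ∀ r p q → (p +ₚ q) *ₚ r ≈ₚ p *ₚ r +ₚ q *ₚ r
  *ₚ-distribʳ r [] q = ≈ₚ-refl
  *ₚ-distribʳ r (a ∷ p) [] = ≈ₚ-sym (+ₚ-identityʳ _)
  *ₚ-distribʳ r (a ∷ p) (b ∷ q) =
    ≈ₚ-trans (+ₚ-cong (·ₚ-distribʳ a b r) (∷≈∷ (sym (+-identityˡ 0#)) (*ₚ-distribʳ r p q)))
             (interchange (a ·ₚ r) (b ·ₚ r) (0# ∷ (p *ₚ r)) (0# ∷ (q *ₚ r)))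

  *ₚ-distribˡ : ∀ p q r → p *ₚ (q +ₚ r) ≈ₚ p *ₚ q +ₚ p *ₚ r
  *ₚ-distribˡ p q r =
    ≈ₚ-trans (*ₚ-comm p (q +ₚ r))
      (≈ₚ-trans (*ₚ-distribʳ p q r) (+ₚ-cong (*ₚ-comm q p) (*ₚ-comm r p)))

  ·ₚ-*ₚ : ∀ a p q → (a ·ₚ p) *ₚ q ≈ₚ a ·ₚ (p *ₚ q)
  ·ₚ-*ₚ a [] q = []≈[]
  ·ₚ-*ₚ a (b ∷ p) q =
    ≈ₚ-trans (+ₚ-cong (·ₚ-assoc a b q) (∷≈∷ (sym (zeroʳ a)) (·ₚ-*ₚ a p q)))
             (≈ₚ-sym (·ₚ-distribˡ a (b ·ₚ q) (0# ∷ (p *ₚ q))))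

  *ₚ-assoc : ∀ p q r → (p *ₚ q) *ₚ r ≈ₚ p *ₚ (q *ₚ r)
  *ₚ-assoc [] q r = []≈[]
  *ₚ-assoc (a ∷ p) q r =
    ≈ₚ-trans (*ₚ-distribʳ r (a ·ₚ q) (0# ∷ (p *ₚ q)))
      (+ₚ-cong (·ₚ-*ₚ a q r) (≈ₚ-trans (0∷-*ₚ (p *ₚ q) r) (∷≈∷ refl (*ₚ-assoc p q r))))

  *ₚ-identityˡ : ∀ p → 1ₚ *ₚ p ≈ₚ p
  *ₚ-identityˡ p = ≈ₚ-trans (const-*ₚ 1# p) (·ₚ-identityˡ p)

  *ₚ-identityʳ : ∀ p → p *ₚ 1ₚ ≈ₚ p
  *ₚ-identityʳ p = ≈ₚ-trans (*ₚ-comm p 1ₚ) (*ₚ-identityˡ p)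

  commutativeRing : CommutativeRing c (c ⊔ ℓ)
  commutativeRing = record
    { Carrier = Pol
    ; _≈_ = _≈ₚ_
    ; _+_ = _+ₚ_
    ; _*_ = _*ₚ_
    ; -_ = -ₚ_
    ; 0# = 0ₚ
    ; 1# = 1ₚ
    ; isCommutativeRing = record
      { isRing = record
        { +-isAbelianGroup = record
          { isGroup = record
            { isMonoid = record
              { isSemigroup = CommutativeSemigroup.isSemigroup +ₚ-commutativeSemigroup
              ; identity = +ₚ-identityˡ , +ₚ-identityʳ
              }
            ; inverse = -ₚ-inverseˡ , -ₚ-inverseʳ
            ; ⁻¹-cong = -ₚ-cong
            }
          ; comm = +ₚ-comm
          }
        ; *-cong = *ₚ-cong
        ; *-assoc = *ₚ-assoc
        ; *-identity = *ₚ-identityˡ , *ₚ-identityʳ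
        ; distrib = *ₚ-distribˡ , *ₚ-distribʳ
        }
      ; *-comm = *ₚ-comm
      }
    }

  module ℙ = CommutativeRing commutativeRing

  module ≈ₚ-Reasoning = SetoidReasoning ℙ.setoid
  module ℙ-Group = GroupProperties ℙ.+-group
  module ℙ-Ring = RingProperties ℙ.ring
  module ℙ-Exp = ExpProperties ℙ.semiring

  nonConstant-resp : ∀ {p q} → p ≈ₚ q → NonConstant p → NonConstant q
  nonConstant-resp p≈q p-nc (a , q≈a) = p-nc (a , ≈ₚ-trans p≈q q≈a)

  nonConstant⇒≉0 : ∀ {p} → NonConstant p → ¬ p ≈ₚ 0ₚ
  nonConstant⇒≉0 p-nc p≈0 = p-nc (0# , ≈ₚ-trans p≈0 ([]≈∷ refl []≈[]))

  relPrime⇒+ₚ*ₚ≉0 : ∀ {f g} → RelPrime f g → NonConstant g → ∀ q → ¬ f +ₚ q *ₚ g ≈ₚ 0ₚ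
  relPrime⇒+ₚ*ₚ≉0 {f} {g} f⊥g g-nc q f+qg≈0 = g-nc (f⊥g g (-ₚ q , f≈-q*g) (1ₚ , ≈ₚ-sym (*ₚ-identityˡ g)))
    where
    f≈-q*g : f ≈ₚ -ₚ q *ₚ g
    f≈-q*g = ≈ₚ-trans (ℙ-Group.inverseˡ-unique f (q *ₚ g) f+qg≈0) (ℙ-Ring.-‿distribˡ-* q g)

  eval-cong : ∀ {p q} → p ≈ₚ q → ∀ t → eval p t ≈ eval q t
  eval-cong []≈[] t = refl
  eval-cong ([]≈∷ b≈0 e) t =
    sym (trans (+-cong b≈0 (trans (*-congˡ (sym (eval-cong e t))) (zeroʳ t))) (+-identityʳ 0#))
  eval-cong (∷≈[] a≈0 e) t = trans (+-cong a≈0 (trans (*-congˡ (eval-cong e t)) (zeroʳ t))) (+-identityʳ 0#)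
  eval-cong (∷≈∷ a≈b e) t = +-cong a≈b (*-congˡ (eval-cong e t))

  eval-const : ∀ a t → eval (const a) t ≈ a
  eval-const a t = trans (+-congˡ (zeroʳ t)) (+-identityʳ a)

  eval-+ₚ : ∀ p q t → eval (p +ₚ q) t ≈ eval p t + eval q t
  eval-+ₚ [] q t = sym (+-identityˡ _)
  eval-+ₚ (a ∷ p) [] t = sym (+-identityʳ _)
  eval-+ₚ (a ∷ p) (b ∷ q) t =
    trans (+-congˡ (*-congˡ (eval-+ₚ p q t))) (lemma a b t (eval p t) (eval q t))
    where
    open SemiringSolver commutativeSemiring
    lemma = solve 5 (λ a b t x y → (a :+ b) :+ t :* (x :+ y) := (a :+ t :* x) :+ (b :+ t :* y)) refl

  eval-·ₚ : ∀ a p t → eval (a ·ₚ p) t ≈ a * eval p t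
  eval-·ₚ a [] t = sym (zeroʳ a)
  eval-·ₚ a (b ∷ p) t = trans (+-congˡ (*-congˡ (eval-·ₚ a p t))) (lemma a b t (eval p t))
    where
    open SemiringSolver commutativeSemiring
    lemma = solve 4 (λ a b t x → a :* b :+ t :* (a :* x) := a :* (b :+ t :* x)) refl

  eval-*ₚ : ∀ p q t → eval (p *ₚ q) t ≈ eval p t * eval q t
  eval-*ₚ [] q t = sym (zeroˡ _)
  eval-*ₚ (a ∷ p) q t = begin
    eval (a ·ₚ q +ₚ (0# ∷ p *ₚ q)) t         ≈⟨ eval-+ₚ (a ·ₚ q) (0# ∷ p *ₚ q) t ⟩
    eval (a ·ₚ q) t + (0# + t * eval (p *ₚ q) t) ≈⟨ +-cong (eval-·ₚ a q t) (+-congˡ (*-congˡ (eval-*ₚ p q t))) ⟩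
    a * eval q t + (0# + t * (eval p t * eval q t)) ≈⟨ lemma a t (eval p t) (eval q t) ⟩
    (a + t * eval p t) * eval q t           ∎
    where
    open SemiringSolver commutativeSemiring
    open SetoidReasoning setoid
    lemma = solve 4 (λ a t x y → a :* y :+ (con 0 :+ t :* (x :* y)) := (a :+ t :* x) :* y) refl

  eval-^ₚ : ∀ p n t → eval (p ^ₚ n) t ≈ eval p t ^ n
  eval-^ₚ p zero t = eval-const 1# t
  eval-^ₚ p (suc n) t = trans (eval-*ₚ p (p ^ₚ n) t) (*-congˡ (eval-^ₚ p n t))

module Field {c ℓ : Level} (K : CommutativeRing c ℓ) (isField : IsField K) where
  open CommutativeRing K
  open Poly K
  open Polynomials K

  *-≉0 : ∀ {a b} → ¬ a ≈ 0# → ¬ b ≈ 0# → ¬ a * b ≈ 0#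
  *-≉0 {a} {b} a≉0 b≉0 ab≈0 with proj₂ isField a a≉0
  ... | a⁻¹ , aa⁻¹≈1 = b≉0 (begin
    b              ≈⟨ *-identityˡ b ⟨
    1# * b         ≈⟨ *-congʳ aa⁻¹≈1 ⟨
    a * a⁻¹ * b    ≈⟨ *-congʳ (*-comm a a⁻¹) ⟩
    a⁻¹ * a * b    ≈⟨ *-assoc a⁻¹ a b ⟩
    a⁻¹ * (a * b)  ≈⟨ *-congˡ ab≈0 ⟩
    a⁻¹ * 0#       ≈⟨ zeroʳ a⁻¹ ⟩
    0#             ∎)
    where open SetoidReasoning setoid

  private
    ∷-*ₚ-∷-≉0 : ∀ {a p b q} →
      (¬ p ≈ₚ 0ₚ → ¬ p *ₚ (b ∷ q) ≈ₚ 0ₚ) → (¬ q ≈ₚ 0ₚ → ¬ (a ∷ p) *ₚ q ≈ₚ 0ₚ) →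
      ¬ a ∷ p ≈ₚ 0ₚ → ¬ b ∷ q ≈ₚ 0ₚ → ¬ (a ∷ p) *ₚ (b ∷ q) ≈ₚ 0ₚ
    -- ≈ on K need not be decidable, but the goal is ⊥, so case splits on a ≈ 0# are still available.
    ∷-*ₚ-∷-≉0 {a} {p} {b} {q} p-ih q-ih a∷p≉0 b∷q≉0 pq≈0@(∷≈[] ab+0≈0 _) =
      ¬¬-excluded-middle {A = a ≈ 0#} λ where
        (yes a≈0) → p-ih (a∷p≉0 ∘ ∷≈[] a≈0) (∷≈[]⇒≈[] (begin
          0# ∷ p *ₚ (b ∷ q)      ≈⟨ 0∷-*ₚ p (b ∷ q) ⟨
          (0# ∷ p) *ₚ (b ∷ q)    ≈⟨ *ₚ-congʳ (∷≈∷ (sym a≈0) (≈ₚ-refl {p})) (b ∷ q) ⟩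
          (a ∷ p) *ₚ (b ∷ q)     ≈⟨ pq≈0 ⟩
          []                     ∎))
        (no a≉0) → ¬¬-excluded-middle {A = b ≈ 0#} λ where
          (yes b≈0) → q-ih (b∷q≉0 ∘ ∷≈[] b≈0) (∷≈[]⇒≈[] (begin
            0# ∷ (a ∷ p) *ₚ q      ≈⟨ *ₚ-0∷ (a ∷ p) q ⟨
            (a ∷ p) *ₚ (0# ∷ q)    ≈⟨ *ₚ-congˡ (a ∷ p) (∷≈∷ (sym b≈0) (≈ₚ-refl {q})) ⟩
            (a ∷ p) *ₚ (b ∷ q)     ≈⟨ pq≈0 ⟩
            []                     ∎))
          (no b≉0) → *-≉0 a≉0 b≉0 (trans (sym (+-identityʳ (a * b))) ab+0≈0)
      where open ≈ₚ-Reasoning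

  *ₚ-≉0 : ∀ p q → ¬ p ≈ₚ 0ₚ → ¬ q ≈ₚ 0ₚ → ¬ p *ₚ q ≈ₚ 0ₚ
  *ₚ-≉0 [] q p≉0 _ _ = p≉0 []≈[]
  *ₚ-≉0 (a ∷ p) [] _ q≉0 _ = q≉0 []≈[]
  *ₚ-≉0 (a ∷ p) (b ∷ q) a∷p≉0 b∷q≉0 =
    ∷-*ₚ-∷-≉0 (λ p≉0 → *ₚ-≉0 p (b ∷ q) p≉0 b∷q≉0) (*ₚ-≉0 (a ∷ p) q a∷p≉0) a∷p≉0 b∷q≉0

  nonConstant-·ₚ : ∀ {a p} → ¬ a ≈ 0# → NonConstant p → NonConstant (a ·ₚ p)
  nonConstant-·ₚ {a} {p} a≉0 p-nc (d , ap≈d) with proj₂ isField a a≉0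
  ... | a⁻¹ , aa⁻¹≈1 = p-nc (a⁻¹ * d , (begin
    p                    ≈⟨ ·ₚ-identityˡ p ⟨
    1# ·ₚ p              ≈⟨ ·ₚ-congʳ (trans (sym aa⁻¹≈1) (*-comm a a⁻¹)) p ⟩
    (a⁻¹ * a) ·ₚ p       ≈⟨ ·ₚ-assoc a⁻¹ a p ⟩
    a⁻¹ ·ₚ (a ·ₚ p)      ≈⟨ ·ₚ-congˡ a⁻¹ ap≈d ⟩
    const (a⁻¹ * d)      ∎))
    where open ≈ₚ-Reasoning

module CharacteristicZero {c ℓ : Level} (K : CommutativeRing c ℓ) (charZero : CharZero K) where
  open CommutativeRing K
  open import Algebra.Properties.Semiring.Exp semiring using (_^_)
  open import Algebra.Properties.Semiring.Mult semiring using (×1-homo-*) renaming (_×_ to _×ₙ_)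
  open import Algebra.Properties.Group +-group using (∙-cancelˡ)
  open Poly K using (2K)

  2K≉0 : ¬ 2K ≈ 0#
  2K≉0 2≈0 = charZero 1 (trans (+-congˡ (+-identityʳ 1#)) 2≈0)

  fromℕ≡×1# : ∀ n → fromℕ K n ≡ n ×ₙ 1#
  fromℕ≡×1# zero = ≡.refl
  fromℕ≡×1# (suc n) = ≡.cong (1# +_) (fromℕ≡×1# n)

  fromℕ-* : ∀ m n → fromℕ K (m ℕ.* n) ≈ fromℕ K m * fromℕ K n
  fromℕ-* m n rewrite fromℕ≡×1# (m ℕ.* n) | fromℕ≡×1# m | fromℕ≡×1# n = ×1-homo-* m n

  fromℕ-^ : ∀ m n → fromℕ K (m ℕ.^ n) ≈ fromℕ K m ^ n
  fromℕ-^ m zero = +-identityʳ 1#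
  fromℕ-^ m (suc n) = trans (fromℕ-* m (m ℕ.^ n)) (*-congˡ (fromℕ-^ m n))

  fromℕ-injective : ∀ {m n} → fromℕ K m ≈ fromℕ K n → m ≡ n
  fromℕ-injective {zero} {zero} _ = ≡.refl
  fromℕ-injective {zero} {suc n} 0≈n+1 = ⊥-elim (charZero n (sym 0≈n+1))
  fromℕ-injective {suc m} {zero} m+1≈0 = ⊥-elim (charZero m m+1≈0)
  fromℕ-injective {suc m} {suc n} m+1≈n+1 = ≡.cong suc (fromℕ-injective (∙-cancelˡ 1# _ _ m+1≈n+1))

module AlgebraicallyClosedField {c ℓ : Level} (K : CommutativeRing c ℓ)
  (isField : IsField K) (algClosed : AlgClosed K) where
  open CommutativeRing K
  open import Algebra.Properties.Semiring.Exp semiring using (_^_; ^-congˡ)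
  open import Algebra.Properties.Group +-group using (x∙y⁻¹≈ε⇒x≈y; inverseʳ-unique)
  open import Algebra.Properties.Ring ring using (-‿involutive; -‿distribʳ-*)
  open Poly K
  open Polynomials K
  open Field K isField

  nonConstant-surjective : ∀ {p} → NonConstant p → ∀ v → ∃ λ t → eval p t ≈ v
  nonConstant-surjective {p} p-nc v with algClosed (p -ₚ const v) p-v-nc
    where
    p-v-nc : NonConstant (p -ₚ const v)
    p-v-nc (a , p-v≈a) =
      p-nc (a + v , ≈ₚ-trans (≈ₚ-sym (ℙ-Group.//-rightDividesˡ (const v) p)) (+ₚ-congʳ p-v≈a (const v)))
  ... | t , p-v[t]≈0 = t , x∙y⁻¹≈ε⇒x≈y (eval p t) v (begin
    eval p t - v                             ≈⟨ +-congˡ (eval-const (- v) t) ⟨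
    eval p t + eval (const (- v)) t          ≈⟨ eval-+ₚ p (const (- v)) t ⟨
    eval (p -ₚ const v) t                    ≈⟨ p-v[t]≈0 ⟩
    0#                                       ∎)
    where open SetoidReasoning setoid

  squareRoot : ∀ a → ∃ λ s → s * s ≈ a
  squareRoot a with algClosed (- a ∷ 0# ∷ 1# ∷ []) t²-a-nc
    where
    t²-a-nc : NonConstant (- a ∷ 0# ∷ 1# ∷ [])
    t²-a-nc (_ , ∷≈∷ _ (∷≈[] _ (∷≈[] 1≈0 _))) = proj₁ isField 1≈0
  ... | s , s²-a≈0 = s , trans (inverseʳ-unique (- a) (s * s) (trans (+-congˡ (horner s)) s²-a≈0)) (-‿involutive a)
    where
    open SemiringSolver commutativeSemiring
    horner : ∀ s → s * s ≈ s * (0# + s * (1# + s * 0#))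
    horner = solve 1 (λ s → s :* s := s :* (con 0 :+ s :* (con 1 :+ s :* con 0))) refl

  nonConstant∣const⇒≈0 : ∀ {p a} → NonConstant p → p ∣ₚ const a → a ≈ 0#
  nonConstant∣const⇒≈0 {p} {a} p-nc (q , a≈qp) with algClosed p p-nc
  ... | t , p[t]≈0 = begin
    a                     ≈⟨ eval-const a t ⟨
    eval (const a) t      ≈⟨ eval-cong a≈qp t ⟩
    eval (q *ₚ p) t       ≈⟨ eval-*ₚ q p t ⟩
    eval q t * eval p t   ≈⟨ *-congˡ p[t]≈0 ⟩
    eval q t * 0#         ≈⟨ zeroʳ (eval q t) ⟩
    0#                    ∎
    where open SetoidReasoning setoid

  nonConstant-*ₚ : ∀ {p q} → ¬ p ≈ₚ 0ₚ → NonConstant q → NonConstant (p *ₚ q)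
  nonConstant-*ₚ {p} {q} p≉0 q-nc (a , pq≈a) = *ₚ-≉0 p q p≉0 (nonConstant⇒≉0 q-nc) (≈ₚ-trans pq≈a (∷≈[] a≈0 []≈[]))
    where
    a≈0 : a ≈ 0#
    a≈0 = nonConstant∣const⇒≈0 q-nc (p , ≈ₚ-sym pq≈a)

  quadraticForm-nonConstant : ¬ 2K ≈ 0# → ∀ {f g} → NonConstant f → NonConstant g → RelPrime f g →
                              ∀ c → NonConstant (f ^ₚ 2 +ₚ c ·ₚ g ^ₚ 2)
  quadraticForm-nonConstant 2≉0 {f} {g} f-nc g-nc f⊥g c (a , form≈a) with squareRoot (- c)
  ... | s , ss≈-c = ¬¬-excluded-middle {A = a ≈ 0#} λ where
      (yes a≈0) → *ₚ-≉0 h k (relPrime⇒+ₚ*ₚ≉0 f⊥g g-nc S) (relPrime⇒+ₚ*ₚ≉0 f⊥g g-nc T)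
                    (≈ₚ-trans hk≈a (∷≈[] a≈0 []≈[]))
      (no a≉0) → ¬h-nonConstant a≉0 λ (d , h≈d) → ¬k-nonConstant a≉0 λ (d′ , k≈d′) →
                 nonConstant-·ₚ 2≉0 f-nc (d + d′ , ≈ₚ-trans (≈ₚ-sym h+k≈2f) (+ₚ-cong h≈d k≈d′))
    where
    open SemiringSolver ℙ.commutativeSemiring
    S T h k : Pol
    S = const s
    T = const (- s)
    h = f +ₚ S *ₚ g
    k = f +ₚ T *ₚ g
    S+T≈0 : S +ₚ T ≈ₚ 0ₚ
    S+T≈0 = ∷≈[] (-‿inverseʳ s) []≈[]
    ST≈c : S *ₚ T ≈ₚ const c
    ST≈c = ≈ₚ-trans (const-*ₚ s T)
             (∷≈∷ (trans (sym (-‿distribʳ-* s s)) (trans (-‿cong ss≈-c) (-‿involutive c))) []≈[])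
    hk≈a : h *ₚ k ≈ₚ const a
    hk≈a = begin
      h *ₚ k                                               ≈⟨ expand f g S T ⟩
      f ^ₚ 2 +ₚ (S +ₚ T) *ₚ (f *ₚ g) +ₚ (S *ₚ T) *ₚ g ^ₚ 2   ≈⟨ ℙ.+-cong (+ₚ-congˡ (f ^ₚ 2) (*ₚ-congʳ S+T≈0 (f *ₚ g)))
                                                                     (*ₚ-congʳ ST≈c (g ^ₚ 2)) ⟩
      f ^ₚ 2 +ₚ [] +ₚ const c *ₚ g ^ₚ 2                      ≈⟨ ℙ.+-cong (+ₚ-identityʳ (f ^ₚ 2)) (const-*ₚ c (g ^ₚ 2)) ⟩
      f ^ₚ 2 +ₚ c ·ₚ g ^ₚ 2                                 ≈⟨ form≈a ⟩
      const a                                               ∎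
      where
      open ≈ₚ-Reasoning
      expand = solve 4 (λ f g S T → (f :+ S :* g) :* (f :+ T :* g)
                                    := f :^ 2 :+ (S :+ T) :* (f :* g) :+ (S :* T) :* g :^ 2) ℙ.refl
    ¬h-nonConstant : ¬ a ≈ 0# → ¬ NonConstant h
    ¬h-nonConstant a≉0 h-nc = a≉0 (nonConstant∣const⇒≈0 h-nc (k , ≈ₚ-sym (≈ₚ-trans (*ₚ-comm k h) hk≈a)))
    ¬k-nonConstant : ¬ a ≈ 0# → ¬ NonConstant k
    ¬k-nonConstant a≉0 k-nc = a≉0 (nonConstant∣const⇒≈0 k-nc (h , ≈ₚ-sym hk≈a))
    h+k≈2f : h +ₚ k ≈ₚ 2K ·ₚ f
    h+k≈2f = begin
      h +ₚ k                      ≈⟨ regroup f g S T ⟩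
      (f +ₚ f) +ₚ (S +ₚ T) *ₚ g   ≈⟨ +ₚ-congˡ (f +ₚ f) (*ₚ-congʳ S+T≈0 g) ⟩
      (f +ₚ f) +ₚ []              ≈⟨ +ₚ-identityʳ (f +ₚ f) ⟩
      f +ₚ f                      ≈⟨ 2K·ₚ-double f ⟨
      2K ·ₚ f                     ∎
      where
      open ≈ₚ-Reasoning
      regroup = solve 4 (λ f g S T → (f :+ S :* g) :+ (f :+ T :* g) := (f :+ f) :+ (S :+ T) :* g) ℙ.refl

  ^ₚ-injectiveʳ : CharZero K → ∀ {p m n} → NonConstant p → p ^ₚ m ≈ₚ p ^ₚ n → m ≡ n
  ^ₚ-injectiveʳ charZero {p} {m} {n} p-nc pᵐ≈pⁿ with nonConstant-surjective p-nc (fromℕ K 2)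
  ... | t , p[t]≈2 = ^-injectiveʳ ℕ.≤-refl (fromℕ-injective (begin
    fromℕ K (2 ℕ.^ m)   ≈⟨ fromℕ-^ 2 m ⟩
    fromℕ K 2 ^ m       ≈⟨ ^-congˡ m p[t]≈2 ⟨
    eval p t ^ m        ≈⟨ eval-^ₚ p m t ⟨
    eval (p ^ₚ m) t     ≈⟨ eval-cong pᵐ≈pⁿ t ⟩
    eval (p ^ₚ n) t     ≈⟨ eval-^ₚ p n t ⟩
    eval p t ^ n        ≈⟨ ^-congˡ n p[t]≈2 ⟩
    fromℕ K 2 ^ n       ≈⟨ fromℕ-^ 2 n ⟨
    fromℕ K (2 ℕ.^ n)   ∎))
    where
    open CharacteristicZero K charZero
    open SetoidReasoning setoid

  pythagoreanExponents : CharZero K → ∀ {P Q R} → NonConstant P → NonConstant Q → NonConstant R →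
    P ^ₚ 2 +ₚ Q ^ₚ 2 ≈ₚ R ^ₚ 2 → ∀ {x y z} → P ^ₚ x +ₚ Q ^ₚ y ≈ₚ R ^ₚ z →
    (x ≡ 2 × y ≡ 2) ⊎ (x ≡ 2 × z ≡ 2) ⊎ (y ≡ 2 × z ≡ 2) → x ≡ 2 × y ≡ 2 × z ≡ 2
  pythagoreanExponents charZero P-nc Q-nc R-nc pyth eq (inj₁ (≡.refl , ≡.refl)) =
    ≡.refl , ≡.refl , ^ₚ-injectiveʳ charZero R-nc (≈ₚ-trans (≈ₚ-sym eq) pyth)
  pythagoreanExponents charZero {P} P-nc Q-nc R-nc pyth eq (inj₂ (inj₁ (≡.refl , ≡.refl))) =
    ≡.refl , ^ₚ-injectiveʳ charZero Q-nc (ℙ-Group.∙-cancelˡ (P ^ₚ 2) _ _ (≈ₚ-trans eq (≈ₚ-sym pyth))) , ≡.refl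
  pythagoreanExponents charZero {Q = Q} P-nc Q-nc R-nc pyth eq (inj₂ (inj₂ (≡.refl , ≡.refl))) =
    ^ₚ-injectiveʳ charZero P-nc (ℙ-Group.∙-cancelʳ (Q ^ₚ 2) _ _ (≈ₚ-trans eq (≈ₚ-sym pyth))) , ≡.refl , ≡.refl

proposition1p3 : {c ℓ : Level} (K : CommutativeRing c ℓ) → IsField K → CharZero K → AlgClosed K →
  let open Poly K
  in (f g w : Pol) → NonConstant f → NonConstant g → RelPrime f g → ¬ (w ≈ₚ 0ₚ) →
     let A = f ^ₚ 2 -ₚ g ^ₚ 2
         B = 2K ·ₚ (f *ₚ g)
         C = f ^ₚ 2 +ₚ g ^ₚ 2
     in (x y z : ℕ) → 1 ≤ x → 1 ≤ y → 1 ≤ z →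
        (w *ₚ A) ^ₚ x +ₚ (w *ₚ B) ^ₚ y ≈ₚ (w *ₚ C) ^ₚ z →
        ((x ≡ 2 × y ≡ 2) ⊎ (x ≡ 2 × z ≡ 2) ⊎ (y ≡ 2 × z ≡ 2)) →
        (x ≡ 2 × y ≡ 2 × z ≡ 2)
proposition1p3 K isField charZero algClosed f g w f-nc g-nc f⊥g w≉0 _ _ _ _ _ _ =
  pythagoreanExponents charZero
    (nonConstant-*ₚ w≉0 A-nc) (nonConstant-*ₚ w≉0 B-nc) (nonConstant-*ₚ w≉0 C-nc) pythagoras
  where
  open CommutativeRing K using (1#; -_)
  open Poly K
  open Polynomials K
  open Field K isField
  open AlgebraicallyClosedField K isField algClosed
  open CharacteristicZero K charZero using (2K≉0)

  A-nc : NonConstant (f ^ₚ 2 -ₚ g ^ₚ 2)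
  A-nc = nonConstant-resp (+ₚ-congˡ (f ^ₚ 2) (≈ₚ-sym (-ₚ≈-1#·ₚ (g ^ₚ 2))))
           (quadraticForm-nonConstant 2K≉0 f-nc g-nc f⊥g (- 1#))

  B-nc : NonConstant (2K ·ₚ (f *ₚ g))
  B-nc = nonConstant-·ₚ 2K≉0 (nonConstant-*ₚ (nonConstant⇒≉0 f-nc) g-nc)

  C-nc : NonConstant (f ^ₚ 2 +ₚ g ^ₚ 2)
  C-nc = nonConstant-resp (+ₚ-congˡ (f ^ₚ 2) (·ₚ-identityˡ (g ^ₚ 2)))
           (quadraticForm-nonConstant 2K≉0 f-nc g-nc f⊥g 1#)

  pythagoras : (w *ₚ (f ^ₚ 2 -ₚ g ^ₚ 2)) ^ₚ 2 +ₚ (w *ₚ (2K ·ₚ (f *ₚ g))) ^ₚ 2 ≈ₚ (w *ₚ (f ^ₚ 2 +ₚ g ^ₚ 2)) ^ₚ 2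
  pythagoras = ≈ₚ-trans (+ₚ-congˡ _ (ℙ-Exp.^-congˡ 2 (*ₚ-congˡ w (2K·ₚ-double (f *ₚ g)))))
                        (euclidsFormula commutativeRing w f g)
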